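{- Let $N=(ST,suc,\{nei_a\}_{a\in AG},L)$ be a single-coalition-first neighborhood model with neighborhood functions $\{nei_C\}_{C\subseteq AG}$. The following two conditions are equivalent: (1) there is $r\in ST$ such that for every $a\in AG$ and $s\in ST$, there is a unique $\{a\}$-history from $r$ to $s$; (2) there is $r\in ST$ such that for every $C\subseteq AG$ and $s\in ST$, there is a unique $C$-history from $r$ to $s$.
   Context: $AG$ is a finite nonempty set of agents, $AP$ a countable set of atomic propositions. A single-coalition-first neighborhood model is $N=(ST,suc,\{nei_a\}_{a\in AG},L)$ with $ST$ nonempty, $suc:ST\to\mathcal P(ST)$, $L:ST\to\mathcal P(AP)$, and for all $a,s$, $nei_a(s)\subseteq\mathcal P(ST)$ a cover of $suc(s)$ (its union is $suc(s)$, $\emptyset\notin nei_a(s)$). For families of nonempty sets, $\Delta_1\odot\Delta_2=\{Y_1\cap Y_2\mid Y_1\in\Delta_1,Y_2\in\Delta_2,Y_1\cap Y_2\neq\emptyset\}$, extended to finitely many families ($\bigodot\{\Delta\}=\Delta$). Neighborhood functions: $nei_C(s)=\emptyset$ if $suc(s)=\emptyset$; $\{suc(s)\}$ if $suc(s)\neq\emptyset$ and $C=\emptyset$; $\bigodot\{nei_a(s)\mid a\in C\}$ otherwise. For $C\subseteq AG$, a $C$-history from $s_0$ to $s_n$ is either the one-element sequence $(s_0)$ (from $s_0$ to $s_0$) or a finite sequence $(s_0,Y_1,s_1,\dots,Y_n,s_n)$, $n\ge1$, of states $s_i$ and sets $Y_i\subseteq ST$ with $Y_{i+1}\in nei_C(s_i)$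 and $s_{i+1}\in Y_{i+1}$ for all $0\le i<n$. -}

module Defs where

open import Level using (Level; 0ℓ) renaming (suc to lsuc)
open import Data.Nat using (ℕ)
open import Data.Fin using (Fin)
open import Data.Fin.Subset using (Subset; _∈_)
open import Data.Fin.Subset.Properties using (_∈?_)
open import Data.List using (List; []; _∷_; filter; allFin)
open import Data.Product using (Σ; ∃; _×_; _,_)
open import Data.Empty using (⊥)
open import Relation.Binary.PropositionalEquality using (_≡_)

SubsetOf : Set → Set₁
SubsetOf ST = ST → Set

Family : Set → Set₂
Family ST = SubsetOf ST → Set₁

module _ {ST : Set} where

  _≐_ : SubsetOf ST → SubsetOf ST → Set
  X ≐ Y = (∀ x → X x → Y x) × (∀ x → Y x → X x)

  NonEmpty : SubsetOf ST → Set
  NonEmpty X = Σ ST X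

  _∩_ : SubsetOf ST → SubsetOf ST → SubsetOf ST
  (X ∩ Y) x = X x × Y x

  -- Δ₁ ⊙ Δ₂ = { Y₁ ∩ Y₂ | Y₁ ∈ Δ₁, Y₂ ∈ Δ₂, Y₁ ∩ Y₂ ≠ ∅ }
  -- (membership read up to extensional equality of sets)
  _⊙_ : Family ST → Family ST → Family ST
  (Δ₁ ⊙ Δ₂) Y = Σ (SubsetOf ST) λ Y₁ → Σ (SubsetOf ST) λ Y₂ →
                 Δ₁ Y₁ × Δ₂ Y₂ × NonEmpty (Y₁ ∩ Y₂) × (Y ≐ (Y₁ ∩ Y₂))

record SCFModel (n : ℕ) (AP : Set) : Set₂ where
  field
    ST    : Set
    st₀   : ST                                  -- ST nonempty
    succ  : ST → SubsetOf ST
    nei   : Fin n → ST → Family ST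
    L     : ST → AP → Set
    -- nei a s is a set of subsets: membership respects set equality
    nei-ext   : ∀ a s X Y → X ≐ Y → nei a s X → nei a s Y
    nei-cover : ∀ a s x → succ s x → Σ (SubsetOf ST) λ Y → nei a s Y × Y x
    nei-sub   : ∀ a s Y x → nei a s Y → Y x → succ s x
    nei-nonempty : ∀ a s Y → nei a s Y → NonEmpty Y

  members : Subset n → List (Fin n)
  members C = filter (_∈? C) (allFin n)

  ⨀ : ST → Fin n → List (Fin n) → Family ST
  ⨀ s a []       = nei a s
  ⨀ s a (b ∷ bs) = nei a s ⊙ ⨀ s b bs

  neiCase : ST → List (Fin n) → Family ST
  neiCase s []       Y = Lift₁ (Y ≐ succ s)
    where
      Lift₁ : Set → Set₁
      Lift₁ A = Level.Lift (lsuc 0ℓ) A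
  neiCase s (a ∷ as) Y = ⨀ s a as Y

  -- nei_C(s): empty if succ s = ∅; {succ s} if C = ∅; ⨀ {nei_a s | a ∈ C} otherwise
  neiC : Subset n → ST → Family ST
  neiC C s Y = NonEmpty (succ s) × neiCase s (members C) Y

  -- raw histories: a start state followed by a list of steps (Yᵢ, sᵢ)
  Steps : Set₁
  Steps = List (SubsetOf ST × ST)

  IsHistory : Subset n → ST → Steps → ST → Set₁
  IsHistory C s₀ []            t = Level.Lift (lsuc 0ℓ) (s₀ ≡ t)
  IsHistory C s₀ ((Y , s₁) ∷ h) t = neiC C s₀ Y × Y s₁ × IsHistory C s₁ h t

  _≈H_ : Steps → Steps → Set
  []             ≈H []               = Level.Lift 0ℓ Data.Unit.⊤
    where import Data.Unit
  []             ≈H (_ ∷ _)          = ⊥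
  (_ ∷ _)        ≈H []               = ⊥
  ((Y , s) ∷ h) ≈H ((Y' , s') ∷ h') = (Y ≐ Y') × (s ≡ s') × (h ≈H h')

  UniqueHistory : Subset n → ST → ST → Set₁
  UniqueHistory C r s = Σ Steps λ h → IsHistory C r h s ×
                          (∀ h' → IsHistory C r h' s → h' ≈H h)

{-# OPTIONS --safe #-}
-- Every nei_C(s) covers suc(s), so a history of one coalition can be retagged
-- with neighbourhoods of any other coalition without changing its states.
-- Hence unique {a}-histories from r, for a single agent a, already force any
-- two histories from r to the same state to pass through the same states.
-- If every agent b has unique histories from r, then nei_b(u) is a partition
-- of suc(u) at every u reachable from r: extending a history to u through
-- two b-neighbourhoods containing x gives two {b}-histories to x.  Nonempty
-- intersections of partitions are partitions, so along a history of any
-- coalition each neighbourhood is determined by the state that follows it.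

module Submission where

open import Defs
open import Data.Nat using (ℕ; suc)
open import Data.Fin using (Fin)
open import Data.Fin.Subset using (Subset; ⁅_⁆)
open import Data.Product using (Σ; _×_)

open import Level using (lift)
open import Data.Bool using (true; false)
open import Data.Fin using (zero; suc)
open import Data.Fin.Subset using (Side; inside; outside; ⊥)
open import Data.Fin.Subset.Properties using (_∈?_; ∉⊥)
open import Data.List using (List; []; _∷_; _++_; map; filter; tabulate; allFin)
open import Data.List.Properties using (filter-none; map-tabulate; ∷-injective)
import Data.List.Relation.Unary.All as All
open import Data.Product using (_,_; proj₁; proj₂)
open import Data.Unit using (tt)
open import Data.Vec using (_∷_)
open import Function using (id)
open import Relation.Nullary using (does)
open import Relation.Binary.PropositionalEquality
  using (_≡_; refl; sym; trans; cong; module ≡-Reasoning)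

filter-∈?-map-suc : ∀ {n} (s : Side) (p : Subset n) (xs : List (Fin n)) →
                    filter (_∈? s ∷ p) (map suc xs) ≡ map suc (filter (_∈? p) xs)
filter-∈?-map-suc s p []       = refl
filter-∈?-map-suc s p (x ∷ xs) with does (x ∈? p)
... | true  = cong (suc x ∷_) (filter-∈?-map-suc s p xs)
... | false = filter-∈?-map-suc s p xs

filter-∈?-⊥ : ∀ {n} (xs : List (Fin n)) → filter (_∈? ⊥) xs ≡ []
filter-∈?-⊥ xs = filter-none (_∈? ⊥) (All.universal (λ _ → ∉⊥) xs)

filter-∈?-tabulate-suc : ∀ {n} (s : Side) (p : Subset n) →
                         filter (_∈? s ∷ p) (tabulate suc) ≡ map suc (filter (_∈? p) (allFin n))
filter-∈?-tabulate-suc {n} s p =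
  trans (cong (filter _) (sym (map-tabulate id suc))) (filter-∈?-map-suc s p (allFin n))

filter-∈?-⁅⁆-allFin : ∀ {n} (a : Fin n) → filter (_∈? ⁅ a ⁆) (allFin n) ≡ a ∷ []
filter-∈?-⁅⁆-allFin {suc n} zero =
  cong (zero ∷_) (trans (filter-∈?-tabulate-suc inside ⊥) (cong (map suc) (filter-∈?-⊥ (allFin n))))
filter-∈?-⁅⁆-allFin {suc n} (suc a) =
  trans (filter-∈?-tabulate-suc outside ⁅ a ⁆) (cong (map suc) (filter-∈?-⁅⁆-allFin a))

module _ {n : ℕ} {AP : Set} (N : SCFModel n AP) where
  open SCFModel N

  ≐-refl : {X : SubsetOf ST} → X ≐ X
  ≐-refl = (λ _ x∈X → x∈X) , (λ _ x∈X → x∈X)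

  ≐-sym : {X Y : SubsetOf ST} → X ≐ Y → Y ≐ X
  ≐-sym (X⊆Y , Y⊆X) = Y⊆X , X⊆Y

  ≐-trans : {X Y Z : SubsetOf ST} → X ≐ Y → Y ≐ Z → X ≐ Z
  ≐-trans (X⊆Y , Y⊆X) (Y⊆Z , Z⊆Y) =
    (λ x x∈X → Y⊆Z x (X⊆Y x x∈X)) , (λ x x∈Z → Y⊆X x (Z⊆Y x x∈Z))

  ∩-cong : {X₁ X₂ Y₁ Y₂ : SubsetOf ST} → X₁ ≐ X₂ → Y₁ ≐ Y₂ → (X₁ ∩ Y₁) ≐ (X₂ ∩ Y₂)
  ∩-cong (X₁⊆X₂ , X₂⊆X₁) (Y₁⊆Y₂ , Y₂⊆Y₁) =
    (λ x (x∈X₁ , x∈Y₁) → X₁⊆X₂ x x∈X₁ , Y₁⊆Y₂ x x∈Y₁) ,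
    (λ x (x∈X₂ , x∈Y₂) → X₂⊆X₁ x x∈X₂ , Y₂⊆Y₁ x x∈Y₂)

  ≈H-sym : ∀ h k → h ≈H k → k ≈H h
  ≈H-sym []            []            _               = lift tt
  ≈H-sym ((Y , s) ∷ h) ((Z , t) ∷ k) (Y≐Z , s≡t , h≈k) = ≐-sym Y≐Z , sym s≡t , ≈H-sym h k h≈k

  ≈H-trans : ∀ h k l → h ≈H k → k ≈H l → h ≈H l
  ≈H-trans []            []            []            _ _ = lift tt
  ≈H-trans ((_ , _) ∷ h) ((_ , _) ∷ k) ((_ , _) ∷ l) (X≐Y , s≡t , h≈k) (Y≐Z , t≡u , k≈l) =
    ≐-trans X≐Y Y≐Z , trans s≡t t≡u , ≈H-trans h k l h≈k k≈l

  ++-cancelˡ-≈H : ∀ p {k₁ k₂} → (p ++ k₁) ≈H (p ++ k₂) → k₁ ≈H k₂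
  ++-cancelˡ-≈H []      k₁≈k₂            = k₁≈k₂
  ++-cancelˡ-≈H (_ ∷ p) (_ , _ , p++k≈p++k) = ++-cancelˡ-≈H p p++k≈p++k

  states : Steps → List ST
  states = map proj₂

  ≈H-states : ∀ h k → h ≈H k → states h ≡ states k
  ≈H-states []            []            _             = refl
  ≈H-states ((_ , s) ∷ h) ((_ , t) ∷ k) (_ , refl , h≈k) = cong (s ∷_) (≈H-states h k h≈k)

  ⨀-⊆-succ : ∀ {s} a as {Y x} → ⨀ s a as Y → Y x → succ s x
  ⨀-⊆-succ {s} a []      {Y} {x} Y∈nei x∈Y = nei-sub a s Y x Y∈nei x∈Y
  ⨀-⊆-succ {s} a (_ ∷ _) {x = x} (Y₁ , _ , Y₁∈nei , _ , _ , Y⊆Y₁∩Y₂ , _) x∈Y =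
    nei-sub a s Y₁ x Y₁∈nei (proj₁ (Y⊆Y₁∩Y₂ x x∈Y))

  neiC-⊆-succ : ∀ C {s Y x} → neiC C s Y → Y x → succ s x
  neiC-⊆-succ C (_ , Y∈nei) = neiCase-⊆-succ (members C) Y∈nei
    where
      neiCase-⊆-succ : ∀ as {s Y x} → neiCase s as Y → Y x → succ s x
      neiCase-⊆-succ []       {x = x} (lift (Y⊆succ , _)) x∈Y = Y⊆succ x x∈Y
      neiCase-⊆-succ (a ∷ as) Y∈⨀ x∈Y = ⨀-⊆-succ a as Y∈⨀ x∈Y

  ⨀-covers : ∀ s a as {x} → succ s x → Σ (SubsetOf ST) λ Y → ⨀ s a as Y × Y x
  ⨀-covers s a []       {x} x∈succ = nei-cover a s x x∈succ
  ⨀-covers s a (b ∷ bs) {x} x∈succ with nei-cover a s x x∈succ | ⨀-covers s b bs x∈succ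
  ... | Y₁ , Y₁∈nei , x∈Y₁ | Y₂ , Y₂∈⨀ , x∈Y₂ =
    (Y₁ ∩ Y₂) , (Y₁ , Y₂ , Y₁∈nei , Y₂∈⨀ , (x , x∈Y₁ , x∈Y₂) , ≐-refl) , (x∈Y₁ , x∈Y₂)

  neiC-covers : ∀ C s {x} → succ s x → Σ (SubsetOf ST) λ Y → neiC C s Y × Y x
  neiC-covers C s {x} x∈succ with members C
  ... | []     = succ s , ((x , x∈succ) , lift ≐-refl) , x∈succ
  ... | a ∷ as with ⨀-covers s a as x∈succ
  ...   | Y , Y∈⨀ , x∈Y = Y , ((x , x∈succ) , Y∈⨀) , x∈Y

  nei⇒neiC-⁅⁆ : ∀ {a s Y x} → nei a s Y → Y x → neiC ⁅ a ⁆ s Y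
  nei⇒neiC-⁅⁆ {a} {s} {Y} {x} Y∈nei x∈Y rewrite filter-∈?-⁅⁆-allFin a =
    (x , nei-sub a s Y x Y∈nei x∈Y) , Y∈nei

  NeiPartition : ST → Set₁
  NeiPartition s = ∀ b {B₁ B₂ x} → nei b s B₁ → nei b s B₂ → B₁ x → B₂ x → B₁ ≐ B₂

  ⨀-partition : ∀ {s} → NeiPartition s → ∀ a as {Y₁ Y₂ x} →
                ⨀ s a as Y₁ → ⨀ s a as Y₂ → Y₁ x → Y₂ x → Y₁ ≐ Y₂
  ⨀-partition part a []       Y₁∈nei Y₂∈nei x∈Y₁ x∈Y₂ = part a Y₁∈nei Y₂∈nei x∈Y₁ x∈Y₂
  ⨀-partition part a (b ∷ bs) {x = x}
    (A₁ , D₁ , A₁∈nei , D₁∈⨀ , _ , Y₁≐A₁∩D₁@(Y₁⊆A₁∩D₁ , _))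
    (A₂ , D₂ , A₂∈nei , D₂∈⨀ , _ , Y₂≐A₂∩D₂@(Y₂⊆A₂∩D₂ , _)) x∈Y₁ x∈Y₂ =
    ≐-trans Y₁≐A₁∩D₁ (≐-trans (∩-cong A₁≐A₂ D₁≐D₂) (≐-sym Y₂≐A₂∩D₂))
    where
      x∈A₁∩D₁ = Y₁⊆A₁∩D₁ x x∈Y₁
      x∈A₂∩D₂ = Y₂⊆A₂∩D₂ x x∈Y₂
      A₁≐A₂ = part a A₁∈nei A₂∈nei (proj₁ x∈A₁∩D₁) (proj₁ x∈A₂∩D₂)
      D₁≐D₂ = ⨀-partition part b bs D₁∈⨀ D₂∈⨀ (proj₂ x∈A₁∩D₁) (proj₂ x∈A₂∩D₂)

  neiC-partition : ∀ {s} → NeiPartition s → ∀ C {Y₁ Y₂ x} →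
                   neiC C s Y₁ → neiC C s Y₂ → Y₁ x → Y₂ x → Y₁ ≐ Y₂
  neiC-partition {s} part C (_ , Y₁∈nei) (_ , Y₂∈nei) = neiCase-partition (members C) Y₁∈nei Y₂∈nei
    where
      neiCase-partition : ∀ as {Y₁ Y₂ x} → neiCase s as Y₁ → neiCase s as Y₂ → Y₁ x → Y₂ x → Y₁ ≐ Y₂
      neiCase-partition []       (lift Y₁≐succ) (lift Y₂≐succ) _ _ = ≐-trans Y₁≐succ (≐-sym Y₂≐succ)
      neiCase-partition (a ∷ as) Y₁∈⨀ Y₂∈⨀ = ⨀-partition part a as Y₁∈⨀ Y₂∈⨀

  IsHistory-++ : ∀ {C s t u} h {k} → IsHistory C s h t → IsHistory C t k u → IsHistory C s (h ++ k) u
  IsHistory-++ [] (lift refl) k-hist = k-hist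
  IsHistory-++ (_ ∷ h) (Y∈nei , x∈Y , h-hist) k-hist = Y∈nei , x∈Y , IsHistory-++ h h-hist k-hist

  retag : ∀ D {C s t} h → IsHistory C s h t → Σ Steps λ k → IsHistory D s k t × states k ≡ states h
  retag D []            s≡t                  = [] , s≡t , refl
  retag D ((Y , x) ∷ h) (Y∈nei , x∈Y , h-hist) with retag D h h-hist
  ... | k , k-hist , k~h with neiC-covers D _ (neiC-⊆-succ _ Y∈nei x∈Y)
  ...   | Z , Z∈nei , x∈Z = (Z , x) ∷ k , (Z∈nei , x∈Z , k-hist) , cong (x ∷_) k~h

  UniqueHistory⇒≈H : ∀ {C r s} → UniqueHistory C r s →
                     ∀ h k → IsHistory C r h s → IsHistory C r k s → h ≈H k
  UniqueHistory⇒≈H (l , _ , unique) h k h-hist k-hist =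
    ≈H-trans h l k (unique h h-hist) (≈H-sym k l (unique k k-hist))

  histories-≈H : ∀ {C u s} → (∀ {v} p → IsHistory C u p v → NeiPartition v) →
                 ∀ h₁ h₂ → IsHistory C u h₁ s → IsHistory C u h₂ s → states h₁ ≡ states h₂ → h₁ ≈H h₂
  histories-≈H part []                []                _ _ _ = lift tt
  histories-≈H {C} part ((Y₁ , x) ∷ h₁) ((Y₂ , x′) ∷ h₂)
    (Y₁∈nei , x∈Y₁ , h₁-hist) (Y₂∈nei , x′∈Y₂ , h₂-hist) x∷h₁~x′∷h₂
    with ∷-injective x∷h₁~x′∷h₂
  ... | refl , h₁~h₂ =
    neiC-partition (part [] (lift refl)) C Y₁∈nei Y₂∈nei x∈Y₁ x′∈Y₂ ,
    refl ,
    histories-≈H (λ p p-hist → part (_ ∷ p) (Y₁∈nei , x∈Y₁ , p-hist)) h₁ h₂ h₁-hist h₂-hist h₁~h₂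

  module _ {r : ST} where

    states-unique : ∀ a → (∀ s → UniqueHistory ⁅ a ⁆ r s) →
                    ∀ {C D s} h k → IsHistory C r h s → IsHistory D r k s → states h ≡ states k
    states-unique a unique h k h-hist k-hist
      with retag ⁅ a ⁆ h h-hist | retag ⁅ a ⁆ k k-hist
    ... | h′ , h′-hist , h′~h | k′ , k′-hist , k′~k = begin
      states h   ≡⟨ sym h′~h ⟩
      states h′  ≡⟨ ≈H-states h′ k′ (UniqueHistory⇒≈H (unique _) h′ k′ h′-hist k′-hist) ⟩
      states k′  ≡⟨ k′~k ⟩
      states k   ∎
      where open ≡-Reasoning

    reachable-partition : (∀ b s → UniqueHistory ⁅ b ⁆ r s) →
                          ∀ {C u} p → IsHistory C r p u → NeiPartition u
    reachable-partition unique p p-hist b {B₁} {B₂} {x} B₁∈nei B₂∈nei x∈B₁ x∈B₂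
      with retag ⁅ b ⁆ p p-hist
    ... | q , q-hist , _ =
      proj₁ (++-cancelˡ-≈H q
        (UniqueHistory⇒≈H (unique b x) _ _ (extend B₁∈nei x∈B₁) (extend B₂∈nei x∈B₂)))
      where
        extend : ∀ {B} → nei b _ B → B x → IsHistory ⁅ b ⁆ r (q ++ (B , x) ∷ []) x
        extend B∈nei x∈B = IsHistory-++ q q-hist (nei⇒neiC-⁅⁆ B∈nei x∈B , x∈B , lift refl)

    unique-histories : Fin n → (∀ b s → UniqueHistory ⁅ b ⁆ r s) → ∀ C s → UniqueHistory C r s
    unique-histories a unique C s with unique a s
    ... | h , h-hist , _ with retag C h h-hist
    ...   | k , k-hist , _ =
      k , k-hist , λ k′ k′-hist →
        histories-≈H (reachable-partition unique) k′ k k′-hist k-hist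
          (states-unique a (unique a) k′ k k′-hist k-hist)

theorem6p8 : ∀ {m : ℕ} {AP : Set} (N : SCFModel (suc m) AP) →
    let open SCFModel N in
    ((Σ ST λ r → ∀ (a : Fin (suc m)) (s : ST) → UniqueHistory ⁅ a ⁆ r s) →
      (Σ ST λ r → ∀ (C : Subset (suc m)) (s : ST) → UniqueHistory C r s)) ×
    ((Σ ST λ r → ∀ (C : Subset (suc m)) (s : ST) → UniqueHistory C r s) →
      (Σ ST λ r → ∀ (a : Fin (suc m)) (s : ST) → UniqueHistory ⁅ a ⁆ r s))
theorem6p8 N =
  (λ (r , unique) → r , unique-histories N zero unique) ,
  (λ (r , unique) → r , λ a → unique ⁅ a ⁆)
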